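{- Let $n$ and $k$ be integers with $3\le k<n/2$ and \[ n\ge\begin{cases} 8, & k=3,\\ 10, & k=4,\\ \frac{k(k+1)}{2}, & k \text{ odd and } k\ge 5,\\ \frac{k^2}{2}, & k \text{ even and } k\ge 6. \end{cases} \] Let $j$ be an integer with $1\le j\le n/2$, and write $j=m_0k+j_0$ and $n-j=m_1k+j_1$ with integers $m_0,m_1\ge 0$ and $0\le j_0,j_1<k$. Consider the following four $u_0,v_j$-walks in $GP(n,k)$ (indices mod $n$): \begin{align*} P_1 &= u_0u_1u_2\cdots u_{j_0}\,v_{j_0}v_{k+j_0}v_{2k+j_0}\cdots v_{m_0k+j_0},\\ P_2 &= u_0u_{ -1}u_{ -2}\cdots u_{ -(k-j_0)}\,v_{ -(k-j_0)}v_{j_0}v_{k+j_0}\cdots v_{m_0k+j_0},\\ P_3 &= u_0u_{ -1}u_{ -2}\cdots u_{ -j_1}\,v_{ -j_1}v_{ -(k+j_1)}v_{ -(2k+j_1)}\cdots v_{ -(m_1k+j_1)},\\ P_4 &= u_0u_1u_2\cdots u_{k-j_1}\,v_{k-j_1}v_{ -j_1}v_{ -k-j_1}\cdots v_{ -m_1k-j_1}, \end{align*} of lengths $j_0+m_0+1$, $(k-j_0)+m_0+2$, $j_1+m_1+1$ and $(k-j_1)+m_1+2$, respectively. Then every $u_0,v_j$-path of minimum length in $GP(n,k)$ contains exactly one spoke and is of one of the four types $P_1,P_2,P_3,P_4$.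
   Context: For $n\ge 3$ and $1\le k<n/2$, the generalized Petersen graph $GP(n,k)$ has vertex set $\{u_i: i\in\mathbb{Z}_n\}\cup\{v_i: i\in\mathbb{Z}_n\}$ and edge set consisting of outer edges $u_iu_{i+1}$, inner edges $v_iv_{i+k}$, and spokes $u_iv_i$, for $i\in\mathbb{Z}_n$ (indices mod $n$, so $u_{ -i}=u_{n-i}$, $v_{ -i}=v_{n-i}$). -}

module Defs where

open import Data.Nat using (ℕ; zero; suc; _+_; _*_; _∸_; _<_; _%_; ⌊_/2⌋)
open import Data.Product using (_×_)
open import Data.Sum using (_⊎_)
open import Data.List using (List; []; _∷_; _++_; map; upTo; head; last; length)
open import Data.List.Relation.Unary.Unique.Propositional using (Unique)
open import Data.Maybe using (just)
open import Relation.Binary.PropositionalEquality using (_≡_)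

-- Reduction mod n (for n = 0 it is the identity; only n ≥ 3 is used).
mod : ℕ → ℕ → ℕ
mod zero    x = x
mod (suc m) x = x % suc m

neg : ℕ → ℕ → ℕ
neg n x = mod n (n ∸ mod n x)

-- Vertices of GP(n,k): u i and v i, with i a representative in {0,…,n-1}.
data V : Set where
  u v : ℕ → V

Adj : ℕ → ℕ → V → V → Set
Adj n k (u i) (u j) = i < n × j < n × (j ≡ mod n (i + 1) ⊎ i ≡ mod n (j + 1))
Adj n k (v i) (v j) = i < n × j < n × (j ≡ mod n (i + k) ⊎ i ≡ mod n (j + k))
Adj n k (u i) (v j) = i < n × i ≡ j
Adj n k (v i) (u j) = i < n × i ≡ j

data Chain (n k : ℕ) : List V → Set where
  nil  : Chain n k []
  one  : ∀ x → Chain n k (x ∷ [])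
  cons : ∀ {x y l} → Adj n k x y → Chain n k (y ∷ l) → Chain n k (x ∷ y ∷ l)

IsWalk : ℕ → ℕ → V → V → List V → Set
IsWalk n k x y l = Chain n k l × head l ≡ just x × last l ≡ just y

IsPath : ℕ → ℕ → V → V → List V → Set
IsPath n k x y l = IsWalk n k x y l × Unique l

len : List V → ℕ
len l = length l ∸ 1

isSpoke : V → V → ℕ
isSpoke (u _) (v _) = 1
isSpoke (v _) (u _) = 1
isSpoke _ _ = 0

spokes : List V → ℕ
spokes (x ∷ y ∷ l) = isSpoke x y + spokes (y ∷ l)
spokes _ = 0

IsShortestPath : ℕ → ℕ → V → V → List V → Set
IsShortestPath n k x y l = IsPath n k x y l × (∀ l′ → IsPath n k x y l′ → len l Data.Nat.≤ len l′)

boundGen : ℕ → ℕ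
boundGen k with k % 2
... | zero  = ⌊ k * k /2⌋
... | suc _ = ⌊ k * suc k /2⌋

bound : ℕ → ℕ
bound 3 = 8
bound 4 = 10
bound k = boundGen k

P₁ : ℕ → ℕ → ℕ → ℕ → List V
P₁ n k j₀ m₀ = map (λ t → u (mod n t)) (upTo (suc j₀))
            ++ map (λ t → v (mod n (t * k + j₀))) (upTo (suc m₀))

P₂ : ℕ → ℕ → ℕ → ℕ → List V
P₂ n k j₀ m₀ = map (λ t → u (neg n t)) (upTo (suc (k ∸ j₀)))
            ++ v (neg n (k ∸ j₀)) ∷ map (λ t → v (mod n (t * k + j₀))) (upTo (suc m₀))

P₃ : ℕ → ℕ → ℕ → ℕ → List V
P₃ n k j₁ m₁ = map (λ t → u (neg n t)) (upTo (suc j₁))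
            ++ map (λ t → v (neg n (t * k + j₁))) (upTo (suc m₁))

P₄ : ℕ → ℕ → ℕ → ℕ → List V
P₄ n k j₁ m₁ = map (λ t → u (mod n t)) (upTo (suc (k ∸ j₁)))
            ++ v (mod n (k ∸ j₁)) ∷ map (λ t → v (neg n (t * k + j₁))) (upTo (suc m₁))

module Submission where

open import Defs
open import Data.Nat
  using (ℕ; zero; suc; _+_; _*_; _∸_; _≤_; _<_; _%_; _/_; z≤n; s≤s; ⌊_/2⌋; _≤?_; _≟_; NonZero; >-nonZero; >-nonZero⁻¹)
open import Data.Nat.Properties
open import Data.Nat.DivMod
open import Data.Nat.Tactic.RingSolver using (solve; solve-∀)
open import Data.Bool using (Bool; true; false; if_then_else_)
open import Data.Empty using (⊥-elim)
open import Data.Unit using (⊤; tt)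
open import Data.Maybe using (just)
open import Data.Product using (_×_; _,_; ∃; proj₁; proj₂)
import Data.Product as Product
open import Data.Sum using (_⊎_; inj₁; inj₂)
import Data.Sum as Sum
open import Data.List using (List; []; _∷_; _++_; map; upTo; head; last; length; replicate; applyUpTo)
open import Data.List.Properties using (map-upTo; map-cong; length-++; length-replicate)
open import Data.List.Relation.Unary.All as All using (All)
import Data.List.Relation.Unary.AllPairs as AllPairs
open import Data.List.Relation.Unary.Unique.Propositional using (Unique)
open import Relation.Binary.Bundles using (Setoid)
open import Relation.Binary.Structures using (IsEquivalence)
open import Relation.Binary.Definitions using (DecidableEquality; tri<; tri≈; tri>)
open import Relation.Binary.PropositionalEquality
import Relation.Binary.Reasoning.Setoid as SetoidReasoning
open import Relation.Nullary using (yes; no)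
import Relation.Nullary.Decidable as Dec
open import Algebra.Properties.CommutativeSemigroup +-commutativeSemigroup using (xy∙z≈xz∙y)

-- Let A, B (resp. C, D) count the forward and backward outer (resp. inner) edges of a u₀,v_j-walk.
-- Outer edges change the index by ±1 and inner edges by ±k, so j + B + kD ≡ A + kC (mod n), and
-- the walk uses at least one spoke. A shortest path is no longer than any of the walks P₁, …, P₄
-- (shortcut them to paths), so A + B + C + D is at most j₀ + m₀, (k - j₀) + m₀ + 1, j₁ + m₁ and
-- (k - j₁) + m₁ + 1. The bound on n gives k(A + B + C + D) < n + j, so the congruence is an
-- equation or wraps around n exactly once, and comparing multiples of k then forces (A, B, C, D) to
-- be the profile of one of P₁, …, P₄, with a single spoke. A walk with one spoke that moves in one
-- direction on each rim is determined by its profile, so the path is that Pᵢ.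

-- Arithmetic

halve-≤ : ∀ x y → 2 * x ≤ suc (2 * y) → x ≤ y
halve-≤ x y le = ≤-pred (*-cancelˡ-< 2 x (suc y) (≤-trans (s≤s le) (≤-reflexive (sym (*-suc 2 y)))))

*-≤-from-half : ∀ k h x n → ⌊ k * (2 * h) /2⌋ ≤ n → x ≤ h → k * x ≤ n
*-≤-from-half k h x n b x≤h = ≤-trans (*-monoʳ-≤ k x≤h) (subst (_≤ n) half b)
  where
  open ≡-Reasoning
  half : ⌊ k * (2 * h) /2⌋ ≡ k * h
  half = begin
    ⌊ k * (2 * h) /2⌋    ≡⟨ cong ⌊_/2⌋ (solve (k ∷ h ∷ [])) ⟩
    ⌊ k * h + k * h /2⌋  ≡⟨ n≡⌊n+n/2⌋ (k * h) ⟨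
    k * h                ∎

bound⇒*-≤ : ∀ {k n} x → 3 ≤ k → bound k ≤ n → 2 * x ≤ suc k → k * x ≤ n
bound⇒*-≤ {1} _ (s≤s ())
bound⇒*-≤ {2} _ (s≤s (s≤s ()))
bound⇒*-≤ {3} {n} x _ b le = *-≤-from-half 3 2 x n (≤-trans (m≤m+n 6 2) b) (halve-≤ x 2 (m≤n⇒m≤1+n le))
bound⇒*-≤ {4} {n} x _ b le = *-≤-from-half 4 2 x n (≤-trans (m≤m+n 8 2) b) (halve-≤ x 2 le)
bound⇒*-≤ {k@(suc (suc (suc (suc (suc _)))))} {n} x _ b le with k % 2 in parity
... | zero = *-≤-from-half k h x n (subst (λ z → ⌊ k * z /2⌋ ≤ n) k≡2h b)
               (halve-≤ x h (subst (λ z → 2 * x ≤ suc z) k≡2h le))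
  where
  h = k / 2
  k≡2h : k ≡ 2 * h
  k≡2h = trans (m≡m%n+[m/n]*n k 2) (trans (cong (_+ h * 2) parity) (*-comm h 2))
... | suc zero = *-≤-from-half k (suc h) x n (subst (λ z → ⌊ k * z /2⌋ ≤ n) 1+k≡2[1+h] b)
                   (halve-≤ x (suc h) (m≤n⇒m≤1+n (≤-trans le (≤-reflexive 1+k≡2[1+h]))))
  where
  h = k / 2
  1+k≡2[1+h] : suc k ≡ 2 * suc h
  1+k≡2[1+h] = trans (cong suc (trans (m≡m%n+[m/n]*n k 2) (cong (_+ h * 2) parity)))
                     (trans (cong (2 +_) (*-comm h 2)) (sym (*-suc 2 h)))
... | suc (suc _) = ⊥-elim (<⇒≱ (m%n<n k 2) (≤-trans (s≤s (s≤s z≤n)) (≤-reflexive (sym parity))))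

*-quotient<dividend : ∀ {k j m₀ j₀} → j ≡ m₀ * k + j₀ → 0 < j₀ → k * m₀ < j
*-quotient<dividend {k} {j} {m₀} {j₀} refl 0<j₀ = subst (_< m₀ * k + j₀) (*-comm m₀ k) (m<m+n (m₀ * k) 0<j₀)

*-≤-split : ∀ {n j m₀ c} k a → k * a ≤ n → k * m₀ < j → c ≤ a + m₀ → k * c < n + j
*-≤-split {n} {j} {m₀} k a ka≤n km₀<j c≤ =
  ≤-<-trans (*-monoʳ-≤ k c≤) (subst (_< n + j) (sym (*-distribˡ-+ k a m₀)) (+-mono-≤-< ka≤n km₀<j))

complement-half : ∀ {k j₀} → j₀ ≤ k → 2 + k ≤ 2 * j₀ → 2 * (k ∸ j₀ + 1) ≤ suc k
complement-half {k} {j₀} j₀≤k 2+k≤2j₀ = go (k ∸ j₀) (m∸n+n≡m j₀≤k)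
  where
  open ≤-Reasoning
  go : ∀ x → x + j₀ ≡ k → 2 * (x + 1) ≤ suc k
  go x refl = +-cancelʳ-≤ (2 * j₀) _ _ (begin
    2 * (x + 1) + 2 * j₀          ≡⟨ solve (x ∷ j₀ ∷ []) ⟩
    suc (x + j₀) + suc (x + j₀)   ≤⟨ +-monoʳ-≤ (suc (x + j₀)) (≤-trans (n≤1+n _) 2+k≤2j₀) ⟩
    suc (x + j₀) + 2 * j₀         ∎)

-- Either j₀ or k - j₀ + 1 is at most (k + 1)/2, and the bound on n makes k times it at most n.
*-cost<n+j : ∀ {k n j m₀ j₀ c} → 3 ≤ k → bound k ≤ n → 0 < n → j ≡ m₀ * k + j₀ → j₀ < k →
             c ≤ j₀ + m₀ → c ≤ (k ∸ j₀) + suc m₀ → k * c < n + j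
*-cost<n+j {k} {n} {j} {m₀} {zero} _ _ 0<n j≡ _ c≤₁ _ =
  ≤-<-trans (*-monoʳ-≤ k c≤₁) (subst (_< n + j) j≡km₀ (m<n+m j 0<n))
  where
  j≡km₀ : j ≡ k * m₀
  j≡km₀ = trans j≡ (trans (+-identityʳ (m₀ * k)) (*-comm m₀ k))
*-cost<n+j {k} {j₀ = j₀@(suc _)} 3≤k b _ j≡ j₀<k c≤₁ c≤₂ with 2 * j₀ ≤? suc k
... | yes 2j₀≤ = *-≤-split k j₀ (bound⇒*-≤ j₀ 3≤k b 2j₀≤) (*-quotient<dividend {k} j≡ (s≤s z≤n)) c≤₁
... | no 2j₀≰  = *-≤-split k (k ∸ j₀ + 1)
                   (bound⇒*-≤ (k ∸ j₀ + 1) 3≤k b (complement-half (<⇒≤ j₀<k) (≰⇒> 2j₀≰)))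
                   (*-quotient<dividend {k} j≡ (s≤s z≤n))
                   (≤-trans c≤₂ (≤-reflexive (sym (+-assoc (k ∸ j₀) 1 _))))

multiple-cases : ∀ n a b →
  a * n ≡ b * n ⊎ a * n ≡ b * n + n ⊎ a * n + n ≤ b * n ⊎ b * n + 2 * n ≤ a * n
multiple-cases n a b with <-cmp a b
... | tri≈ _ refl _ = inj₁ refl
... | tri< a<b _ _  = inj₂ (inj₂ (inj₁ (≤-trans (≤-reflexive (+-comm (a * n) n)) (*-monoˡ-≤ n a<b))))
... | tri> _ _ b<a with m≤n⇒m<n∨m≡n b<a
...   | inj₂ refl  = inj₂ (inj₁ (+-comm n (b * n)))
...   | inj₁ 1+b<a = inj₂ (inj₂ (inj₂ (≤-trans (≤-reflexive 2+b) (*-monoˡ-≤ n 1+b<a))))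
  where
  2+b : b * n + 2 * n ≡ suc (suc b) * n
  2+b = trans (+-comm (b * n) (2 * n)) (sym (*-distribʳ-+ n 2 b))

%-≡⇒cases : ∀ n .{{_ : NonZero n}} M N → M % n ≡ N % n →
  M ≡ N ⊎ M ≡ N + n ⊎ M + n ≤ N ⊎ N + 2 * n ≤ M
%-≡⇒cases n M N M≡N = subst₂ Cases (sym M≡) (sym N≡) (shift (M % n) (multiple-cases n (M / n) (N / n)))
  where
  Cases : ℕ → ℕ → Set
  Cases X Y = X ≡ Y ⊎ X ≡ Y + n ⊎ X + n ≤ Y ⊎ Y + 2 * n ≤ X
  shift : ∀ r {X Y} → Cases X Y → Cases (r + X) (r + Y)
  shift r         (inj₁ eq)               = inj₁ (cong (r +_) eq)
  shift r {Y = Y} (inj₂ (inj₁ eq))        = inj₂ (inj₁ (trans (cong (r +_) eq) (sym (+-assoc r Y n))))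
  shift r {X}     (inj₂ (inj₂ (inj₁ le))) =
    inj₂ (inj₂ (inj₁ (≤-trans (≤-reflexive (+-assoc r X n)) (+-monoʳ-≤ r le))))
  shift r {Y = Y} (inj₂ (inj₂ (inj₂ le))) =
    inj₂ (inj₂ (inj₂ (≤-trans (≤-reflexive (+-assoc r Y (2 * n))) (+-monoʳ-≤ r le))))
  M≡ : M ≡ M % n + M / n * n
  M≡ = m≡m%n+[m/n]*n M n
  N≡ : N ≡ M % n + N / n * n
  N≡ = trans (m≡m%n+[m/n]*n N n) (cong (_+ N / n * n) (sym M≡N))

quotient-split : ∀ {J x k m p q r s} → J + x ≡ k → p + k * r ≡ m * k + J + q + k * s →
  (∃ λ t → p ≡ J + q + k * t × r + t ≡ s + m) ⊎ (∃ λ t → q ≡ p + x + k * t × r ≡ suc (s + m) + t)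
quotient-split {J} {x} {k} {m} {p} {q} {r} {s} _ e with r ≤? s + m
... | yes r≤ with m≤n⇒∃[o]m+o≡n r≤
...   | t , r+t≡ = inj₁ (t , +-cancelʳ-≡ (k * r) p (J + q + k * t) (begin
  p + k * r                  ≡⟨ e ⟩
  m * k + J + q + k * s      ≡⟨ solve (k ∷ J ∷ m ∷ q ∷ s ∷ []) ⟩
  J + q + k * (s + m)        ≡⟨ cong (λ z → J + q + k * z) r+t≡ ⟨
  J + q + k * (r + t)        ≡⟨ solve (k ∷ J ∷ q ∷ r ∷ t ∷ []) ⟩
  J + q + k * t + k * r      ∎) , r+t≡)
  where open ≡-Reasoning
quotient-split {J} {x} {k} {m} {p} {q} {r} {s} J+x≡k e | no r≰ with m≤n⇒∃[o]m+o≡n (≰⇒> r≰)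
... | t , refl = inj₂ (t , sym (+-cancelʳ-≡ (J + m * k + k * s) (p + x + k * t) q (begin
  p + x + k * t + (J + m * k + k * s)   ≡⟨ solve (k ∷ J ∷ x ∷ m ∷ p ∷ s ∷ t ∷ []) ⟩
  p + (J + x) + k * (s + m + t)         ≡⟨ cong (λ z → p + z + k * (s + m + t)) J+x≡k ⟩
  p + k + k * (s + m + t)               ≡⟨ solve (k ∷ m ∷ p ∷ s ∷ t ∷ []) ⟩
  p + k * (suc (s + m) + t)             ≡⟨ e ⟩
  m * k + J + q + k * s                 ≡⟨ solve (k ∷ J ∷ m ∷ q ∷ s ∷ []) ⟩
  q + (J + m * k + k * s)               ∎)) , refl)
  where open ≡-Reasoning

m+n≤m⇒n≡0 : ∀ m {n} → m + n ≤ m → n ≡ 0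
m+n≤m⇒n≡0 m {n} le = n≤0⇒n≡0 (+-cancelˡ-≤ m n 0 (≤-trans le (≤-reflexive (sym (+-identityʳ m)))))

k*n≤n⇒n≡0 : ∀ {k} n → 2 ≤ k → k * n ≤ n → n ≡ 0
k*n≤n⇒n≡0 zero    _   _  = refl
k*n≤n⇒n≡0 (suc n) 2≤k le = ⊥-elim (<⇒≱ (m<m+n (suc n) (s≤s z≤n)) (≤-trans (*-monoˡ-≤ (suc n) 2≤k) le))

n+n≡0⇒n≡0 : ∀ n → n + n ≡ 0 → n ≡ 0
n+n≡0⇒n≡0 n = m+n≡0⇒m≡0 n

exact-profile : ∀ {J x k m p q r s} → J + x ≡ k → 2 ≤ k → p + k * r ≡ m * k + J + q + k * s →
  p + q + r + s ≤ J + m → p + q + r + s ≤ x + suc m →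
  (p ≡ J × q ≡ 0 × r ≡ m × s ≡ 0) ⊎ (p ≡ 0 × q ≡ x × r ≡ suc m × s ≡ 0)
exact-profile {J} {x} {k} {m} {p} {q} {r} {s} J+x≡k 2≤k e c≤₁ c≤₂
  with quotient-split {J} {x} {k} {m} {p} {q} {r} {s} J+x≡k e
... | inj₁ (t , refl , r+t≡) = inj₁ (p≡J , q≡0 , r≡m , s≡0)
  where
  open ≤-Reasoning
  excess≤t : k * t + (q + q + (s + s)) ≤ t
  excess≤t = +-cancelˡ-≤ (J + m) _ _ (begin
    J + m + (k * t + (q + q + (s + s)))   ≡⟨ solve (J ∷ m ∷ k ∷ t ∷ q ∷ s ∷ []) ⟩
    J + (s + m) + s + (k * t + (q + q))   ≡⟨ cong (λ z → J + z + s + (k * t + (q + q))) r+t≡ ⟨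
    J + (r + t) + s + (k * t + (q + q))   ≡⟨ solve (J ∷ r ∷ t ∷ s ∷ k ∷ q ∷ []) ⟩
    J + q + k * t + q + r + s + t         ≤⟨ +-monoˡ-≤ t c≤₁ ⟩
    J + m + t                             ∎)
  t≡0 : t ≡ 0
  t≡0 = k*n≤n⇒n≡0 t 2≤k (m+n≤o⇒m≤o (k * t) excess≤t)
  rest≡0 : q + q + (s + s) ≡ 0
  rest≡0 = n≤0⇒n≡0 (subst (q + q + (s + s) ≤_) t≡0 (m+n≤o⇒n≤o (k * t) excess≤t))
  q≡0 = n+n≡0⇒n≡0 q (m+n≡0⇒m≡0 (q + q) rest≡0)
  s≡0 = n+n≡0⇒n≡0 s (m+n≡0⇒n≡0 (q + q) rest≡0)
  p≡J : J + q + k * t ≡ J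
  p≡J = trans (cong₂ (λ a b → J + a + k * b) q≡0 t≡0) (trans (cong (J + 0 +_) (*-zeroʳ k)) (solve (J ∷ [])))
  r≡m : r ≡ m
  r≡m = trans (sym (+-identityʳ r)) (trans (cong (r +_) (sym t≡0)) (trans r+t≡ (cong (_+ m) s≡0)))
... | inj₂ (t , refl , refl) = inj₂ (p≡0 , q≡x , r≡1+m , s≡0)
  where
  regroup : x + suc m + (k * t + t + (p + p + (s + s))) ≡ p + (p + x + k * t) + (suc (s + m) + t) + s
  regroup = solve (k ∷ t ∷ p ∷ s ∷ x ∷ m ∷ [])
  excess≡0 : k * t + t + (p + p + (s + s)) ≡ 0
  excess≡0 = m+n≤m⇒n≡0 (x + suc m) (≤-trans (≤-reflexive regroup) c≤₂)
  t≡0 = m+n≡0⇒n≡0 (k * t) (m+n≡0⇒m≡0 (k * t + t) excess≡0)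
  rest≡0 = m+n≡0⇒n≡0 (k * t + t) excess≡0
  p≡0 = n+n≡0⇒n≡0 p (m+n≡0⇒m≡0 (p + p) rest≡0)
  s≡0 = n+n≡0⇒n≡0 s (m+n≡0⇒n≡0 (p + p) rest≡0)
  q≡x : p + x + k * t ≡ x
  q≡x = trans (cong₂ (λ a b → a + x + k * b) p≡0 t≡0) (trans (cong (x +_) (*-zeroʳ k)) (+-identityʳ x))
  r≡1+m : suc (s + m) + t ≡ suc m
  r≡1+m = trans (cong₂ (λ a b → suc (a + m) + b) s≡0 t≡0) (cong suc (+-identityʳ m))

m+k*n≤k*[m+n] : ∀ {k} a c → 1 ≤ k → a + k * c ≤ k * (a + c)
m+k*n≤k*[m+n] {k} a c 1≤k =
  ≤-trans (+-monoˡ-≤ (k * c) (m≤n*m a k {{>-nonZero 1≤k}})) (≤-reflexive (sym (*-distribˡ-+ k a c)))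

+-regroup : ∀ a b c d → (a + c) + (b + d) ≡ a + b + c + d
+-regroup = solve-∀

+-swap-pairs : ∀ a b c d → a + b + c + d ≡ b + a + d + c
+-swap-pairs = solve-∀

wrap-below⇒≤ : ∀ {n j k A B C D} → 1 ≤ k → j + B + k * D + n ≤ A + k * C → n + j ≤ k * (A + B + C + D)
wrap-below⇒≤ {n} {j} {k} {A} {B} {C} {D} 1≤k le = begin
  n + j                 ≡⟨ +-comm n j ⟩
  j + n                 ≤⟨ +-monoˡ-≤ n (≤-trans (m≤m+n j B) (m≤m+n (j + B) (k * D))) ⟩
  j + B + k * D + n     ≤⟨ le ⟩
  A + k * C             ≤⟨ m+k*n≤k*[m+n] A C 1≤k ⟩
  k * (A + C)           ≤⟨ *-monoʳ-≤ k (≤-trans (m≤m+n (A + C) (B + D)) (≤-reflexive (+-regroup A B C D))) ⟩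
  k * (A + B + C + D)   ∎
  where open ≤-Reasoning

wrap-above⇒≤ : ∀ {n j k A B C D} → 1 ≤ k → 2 * j ≤ n → A + k * C + 2 * n ≤ j + B + k * D →
  n + j ≤ k * (A + B + C + D)
wrap-above⇒≤ {n} {j} {k} {A} {B} {C} {D} 1≤k 2j≤n le = +-cancelˡ-≤ j _ _ (begin
  j + (n + j)             ≡⟨ solve (j ∷ n ∷ []) ⟩
  n + 2 * j               ≤⟨ +-monoʳ-≤ n 2j≤n ⟩
  n + n                   ≡⟨ solve (n ∷ []) ⟩
  2 * n                   ≤⟨ m≤n+m (2 * n) (A + k * C) ⟩
  A + k * C + 2 * n       ≤⟨ le ⟩
  j + B + k * D           ≡⟨ +-assoc j B (k * D) ⟩
  j + (B + k * D)         ≤⟨ +-monoʳ-≤ j (m+k*n≤k*[m+n] B D 1≤k) ⟩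
  j + k * (B + D)         ≤⟨ +-monoʳ-≤ j (*-monoʳ-≤ k B+D≤) ⟩
  j + k * (A + B + C + D) ∎)
  where
  open ≤-Reasoning
  B+D≤ : B + D ≤ A + B + C + D
  B+D≤ = ≤-trans (m≤n+m (B + D) (A + C)) (≤-reflexive (+-regroup A B C D))

wrap-once⇒exact : ∀ {n j k m₁ j₁ A B C D} → j ≤ n → n ∸ j ≡ m₁ * k + j₁ →
  j + B + k * D ≡ A + k * C + n → B + k * D ≡ m₁ * k + j₁ + A + k * C
wrap-once⇒exact {n} {j} {k} {m₁} {j₁} {A} {B} {C} {D} j≤n n-j≡ eq = +-cancelˡ-≡ j _ _ (begin
  j + (B + k * D)                  ≡⟨ +-assoc j B (k * D) ⟨
  j + B + k * D                    ≡⟨ eq ⟩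
  A + k * C + n                    ≡⟨ cong (A + k * C +_) (m∸n+n≡m j≤n) ⟨
  A + k * C + (n ∸ j + j)          ≡⟨ cong (λ z → A + k * C + (z + j)) n-j≡ ⟩
  A + k * C + (m₁ * k + j₁ + j)    ≡⟨ solve (A ∷ k ∷ C ∷ m₁ ∷ j₁ ∷ j ∷ []) ⟩
  j + (m₁ * k + j₁ + A + k * C)    ∎)
  where open ≡-Reasoning

classify-profile : ∀ n .{{_ : NonZero n}} {k j m₀ j₀ m₁ j₁ A B C D} →
  3 ≤ k → bound k ≤ n → 2 * j ≤ n → j ≡ m₀ * k + j₀ → j₀ < k → n ∸ j ≡ m₁ * k + j₁ → j₁ < k →
  (j + B + k * D) % n ≡ (A + k * C) % n →
  A + B + C + D ≤ j₀ + m₀ → A + B + C + D ≤ (k ∸ j₀) + suc m₀ →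
  A + B + C + D ≤ j₁ + m₁ → A + B + C + D ≤ (k ∸ j₁) + suc m₁ →
  (A ≡ j₀ × B ≡ 0 × C ≡ m₀ × D ≡ 0) ⊎ (A ≡ 0 × B ≡ k ∸ j₀ × C ≡ suc m₀ × D ≡ 0) ⊎
  (A ≡ 0 × B ≡ j₁ × C ≡ 0 × D ≡ m₁) ⊎ (A ≡ k ∸ j₁ × B ≡ 0 × C ≡ 0 × D ≡ suc m₁)
classify-profile n {k} {j} {m₀} {j₀} {m₁} {j₁} {A} {B} {C} {D}
                 3≤k b 2j≤n j≡ j₀<k n-j≡ j₁<k ≡[n] c≤₁ c≤₂ c≤₃ c≤₄
  with %-≡⇒cases n (j + B + k * D) (A + k * C) ≡[n] | *-cost<n+j 3≤k b (>-nonZero⁻¹ n) j≡ j₀<k c≤₁ c≤₂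
... | inj₁ eq | _ = Sum.map₂ inj₁
  (exact-profile {j₀} {k ∸ j₀} {k} {m₀} {A} {B} {C} {D} (m+[n∸m]≡n (<⇒≤ j₀<k)) (<⇒≤ 3≤k)
    (trans (sym eq) (cong (λ z → z + B + k * D) j≡)) c≤₁ c≤₂)
... | inj₂ (inj₁ eq) | _ = inj₂ (inj₂ (Sum.map swap-components swap-components
  (exact-profile {j₁} {k ∸ j₁} {k} {m₁} {B} {A} {D} {C} (m+[n∸m]≡n (<⇒≤ j₁<k)) (<⇒≤ 3≤k)
    (wrap-once⇒exact {n} {j} {k} {m₁} {j₁} {A} {B} {C} {D} (≤-trans (m≤m+n j (j + 0)) 2j≤n) n-j≡ eq)
    (subst (_≤ j₁ + m₁) (+-swap-pairs A B C D) c≤₃)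
    (subst (_≤ (k ∸ j₁) + suc m₁) (+-swap-pairs A B C D) c≤₄))))
  where
  swap-components : ∀ {P Q R S : Set} → Q × P × S × R → P × Q × R × S
  swap-components (q , p , s , r) = p , q , r , s
... | inj₂ (inj₂ (inj₁ le)) | k*cost<n+j =
  ⊥-elim (<⇒≱ k*cost<n+j (wrap-below⇒≤ {n} {j} {k} {A} {B} {C} {D} (<⇒≤ (<⇒≤ 3≤k)) le))
... | inj₂ (inj₂ (inj₂ le)) | k*cost<n+j =
  ⊥-elim (<⇒≱ k*cost<n+j (wrap-above⇒≤ {n} {j} {k} {A} {B} {C} {D} (<⇒≤ (<⇒≤ 3≤k)) 2j≤n le))

-- Congruence modulo n

module Congruence (n′ : ℕ) where

  private
    n : ℕ
    n = suc n′

  infix 4 _≋_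

  -- A record rather than an abbreviation of a % n ≡ b % n, so that a and b can be inferred.
  record _≋_ (a b : ℕ) : Set where
    constructor %≡⇒≋
    field ≋⇒%≡ : a % n ≡ b % n
  open _≋_ public

  ≋-isEquivalence : IsEquivalence _≋_
  ≋-isEquivalence = record
    { refl  = %≡⇒≋ refl
    ; sym   = λ (%≡⇒≋ p) → %≡⇒≋ (sym p)
    ; trans = λ (%≡⇒≋ p) (%≡⇒≋ q) → %≡⇒≋ (trans p q)
    }

  ≋-setoid : Setoid _ _
  ≋-setoid = record { isEquivalence = ≋-isEquivalence }

  open IsEquivalence ≋-isEquivalence public using () renaming (refl to ≋-refl; sym to ≋-sym; trans to ≋-trans)

  module ≋-Reasoning = SetoidReasoning ≋-setoid

  +-cong-≋ : ∀ {a b c d} → a ≋ b → c ≋ d → a + c ≋ b + d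
  +-cong-≋ {a} {b} {c} {d} (%≡⇒≋ p) (%≡⇒≋ q) = %≡⇒≋ (begin
    (a + c) % n            ≡⟨ %-distribˡ-+ a c n ⟩
    (a % n + c % n) % n    ≡⟨ cong₂ (λ x y → (x + y) % n) p q ⟩
    (b % n + d % n) % n    ≡⟨ %-distribˡ-+ b d n ⟨
    (b + d) % n            ∎)
    where open ≡-Reasoning

  +-congʳ-≋ : ∀ {a b} c → a ≋ b → a + c ≋ b + c
  +-congʳ-≋ c a≋b = +-cong-≋ a≋b ≋-refl

  +-congˡ-≋ : ∀ {a b} c → a ≋ b → c + a ≋ c + b
  +-congˡ-≋ c a≋b = +-cong-≋ ≋-refl a≋b

  %-≋ : ∀ a → a % n ≋ a
  %-≋ a = %≡⇒≋ (m%n%n≡m%n a n)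

  n≋0 : n ≋ 0
  n≋0 = %≡⇒≋ (n%n≡0 n)

  *n≋0 : ∀ t → t * n ≋ 0
  *n≋0 t = %≡⇒≋ (m*n%n≡0 t n)

  reduced-≋⇒≡ : ∀ {a i} → i < n → a ≋ i → i ≡ a % n
  reduced-≋⇒≡ i<n (%≡⇒≋ p) = trans (sym (m<n⇒m%n≡m i<n)) (sym p)

  neg-inverseˡ : ∀ x → neg n x + x ≋ 0
  neg-inverseˡ x = begin
    neg n x + x            ≈⟨ +-congʳ-≋ x (%-≋ (n ∸ x % n)) ⟩
    (n ∸ x % n) + x        ≈⟨ +-congˡ-≋ (n ∸ x % n) (%-≋ x) ⟨
    (n ∸ x % n) + x % n    ≡⟨ m∸n+n≡m (<⇒≤ (m%n<n x n)) ⟩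
    n                      ≈⟨ n≋0 ⟩
    0                      ∎
    where open ≋-Reasoning

  +-cancelʳ-≋ : ∀ {a b} x → a + x ≋ b + x → a ≋ b
  +-cancelʳ-≋ {a} {b} x a+x≋b+x = begin
    a                      ≡⟨ +-identityʳ a ⟨
    a + 0                  ≈⟨ +-congˡ-≋ a (neg-inverseˡ x) ⟨
    a + (neg n x + x)      ≡⟨ cong (a +_) (+-comm (neg n x) x) ⟩
    a + (x + neg n x)      ≡⟨ +-assoc a x (neg n x) ⟨
    a + x + neg n x        ≈⟨ +-congʳ-≋ (neg n x) a+x≋b+x ⟩
    b + x + neg n x        ≡⟨ +-assoc b x (neg n x) ⟩
    b + (x + neg n x)      ≡⟨ cong (b +_) (+-comm x (neg n x)) ⟩
    b + (neg n x + x)      ≈⟨ +-congˡ-≋ b (neg-inverseˡ x) ⟩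
    b + 0                  ≡⟨ +-identityʳ b ⟩
    b                      ∎
    where open ≋-Reasoning

  inverse⇒≡neg : ∀ y x → y + x ≋ 0 → y % n ≡ neg n x
  inverse⇒≡neg y x y+x≋0 =
    ≋⇒%≡ (≋-trans (+-cancelʳ-≋ x (≋-trans y+x≋0 (≋-sym (neg-inverseˡ x)))) (%-≋ (n ∸ x % n)))

-- Removing cycles

_≟ᵛ_ : DecidableEquality V
u i ≟ᵛ u j = Dec.map′ (cong u) (λ { refl → refl }) (i ≟ j)
v i ≟ᵛ v j = Dec.map′ (cong v) (λ { refl → refl }) (i ≟ j)
u _ ≟ᵛ v _ = no λ ()
v _ ≟ᵛ u _ = no λ ()

suffixFrom : V → List V → List V
suffixFrom x []      = []
suffixFrom x (y ∷ l) with x ≟ᵛ y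
... | yes _ = y ∷ l
... | no  _ = suffixFrom x l

-- If x already occurs in l, the closed walk from x back to x is cut out.
prepend : V → List V → List V
prepend x l with suffixFrom x l
... | []    = x ∷ l
... | y ∷ r = y ∷ r

shortcut : List V → List V
shortcut []      = []
shortcut (x ∷ l) = prepend x (shortcut l)

infix 4 _⊑_
data _⊑_ : List V → List V → Set where
  here  : ∀ {l} → l ⊑ l
  there : ∀ {l x m} → l ⊑ m → l ⊑ x ∷ m

suffixFrom≡[] : ∀ x l → suffixFrom x l ≡ [] → All (x ≢_) l
suffixFrom≡[] x []      _ = All.[]
suffixFrom≡[] x (y ∷ l) e with x ≟ᵛ y
... | no x≢y = x≢y All.∷ suffixFrom≡[] x l e

suffixFrom≡∷ : ∀ x l {y r} → suffixFrom x l ≡ y ∷ r → y ≡ x × y ∷ r ⊑ l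
suffixFrom≡∷ x (y ∷ l) e with x ≟ᵛ y
suffixFrom≡∷ x (y ∷ l) refl | yes refl = refl , here
... | no _ = Product.map₂ there (suffixFrom≡∷ x l e)

⊑-unique : ∀ {s l} → s ⊑ l → Unique l → Unique s
⊑-unique here      q                = q
⊑-unique (there s) (_ AllPairs.∷ q) = ⊑-unique s q

⊑-length : ∀ {s l} → s ⊑ l → length s ≤ length l
⊑-length here      = ≤-refl
⊑-length (there s) = m≤n⇒m≤1+n (⊑-length s)

⊑-last : ∀ {y r l} → y ∷ r ⊑ l → last (y ∷ r) ≡ last l
⊑-last here                  = refl
⊑-last (there {m = _ ∷ _} s) = ⊑-last s

-- Walks in GP(n, k)

module GP (n′ k : ℕ) (k≤n : k ≤ suc n′) where

  open Congruence n′

  n : ℕ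
  n = suc n′

  data Step : Set where
    outer⁺ outer⁻ inner⁺ inner⁻ spoke : Step

  _≡ᵇ_ : Step → Step → Bool
  outer⁺ ≡ᵇ outer⁺ = true
  outer⁻ ≡ᵇ outer⁻ = true
  inner⁺ ≡ᵇ inner⁺ = true
  inner⁻ ≡ᵇ inner⁻ = true
  spoke  ≡ᵇ spoke  = true
  _      ≡ᵇ _      = false

  count : Step → List Step → ℕ
  count σ []       = 0
  count σ (τ ∷ σs) = if σ ≡ᵇ τ then suc (count σ σs) else count σ σs

  cost : List Step → ℕ
  cost σs = count outer⁺ σs + count outer⁻ σs + count inner⁺ σs + count inner⁻ σs

  -- Going backwards adds n′ ≡ -1, resp. n ∸ k ≡ -k. A step that does not apply leaves the vertex unchanged.
  move : Step → V → V
  move outer⁺ (u i) = u (mod n (i + 1))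
  move outer⁻ (u i) = u (mod n (i + n′))
  move inner⁺ (v i) = v (mod n (i + k))
  move inner⁻ (v i) = v (mod n (i + (n ∸ k)))
  move spoke  (u i) = v i
  move spoke  (v i) = u i
  move _      x     = x

  index : V → ℕ
  index (u i) = i
  index (v i) = i

  stepOf : ∀ {x y} → Adj n k x y → Step
  stepOf {u _} {u _} (_ , _ , inj₁ _) = outer⁺
  stepOf {u _} {u _} (_ , _ , inj₂ _) = outer⁻
  stepOf {v _} {v _} (_ , _ , inj₁ _) = inner⁺
  stepOf {v _} {v _} (_ , _ , inj₂ _) = inner⁻
  stepOf {u _} {v _} _                = spoke
  stepOf {v _} {u _} _                = spoke

  infixr 5 _▸_
  data Walk : V → V → Set where
    end : ∀ {x} → Walk x x
    _▸_ : ∀ {x y z} → Adj n k x y → Walk y z → Walk x z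

  steps : ∀ {x z} → Walk x z → List Step
  steps end     = []
  steps (a ▸ w) = stepOf a ∷ steps w

  successors : ∀ {x z} → Walk x z → List V
  successors end               = []
  successors (_▸_ {y = y} _ w) = y ∷ successors w

  vertices : ∀ {x z} → Walk x z → List V
  vertices {x} w = x ∷ successors w

  trace : V → List Step → List V
  trace x []       = x ∷ []
  trace x (σ ∷ σs) = x ∷ trace (move σ x) σs

  undo-step : ∀ {i} d e → i < n → d + e ≡ n → i ≡ mod n (mod n (i + d) + e)
  undo-step {i} d e i<n d+e≡n = reduced-≋⇒≡ i<n (begin
    (i + d) % n + e     ≈⟨ +-congʳ-≋ e (%-≋ (i + d)) ⟩
    i + d + e           ≡⟨ trans (+-assoc i d e) (cong (i +_) d+e≡n) ⟩
    i + n               ≈⟨ +-congˡ-≋ i n≋0 ⟩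
    i + 0               ≡⟨ +-identityʳ i ⟩
    i                   ∎)
    where open ≋-Reasoning

  move-stepOf : ∀ {x y} (a : Adj n k x y) → move (stepOf a) x ≡ y
  move-stepOf {u i} {u j} (_ , _ , inj₁ j≡) = cong u (sym j≡)
  move-stepOf {u i} {u j} (_ , j<n , inj₂ i≡) =
    cong u (sym (trans (undo-step 1 n′ j<n refl) (cong (λ z → mod n (z + n′)) (sym i≡))))
  move-stepOf {v i} {v j} (_ , _ , inj₁ j≡) = cong v (sym j≡)
  move-stepOf {v i} {v j} (_ , j<n , inj₂ i≡) =
    cong v (sym (trans (undo-step k (n ∸ k) j<n (m+[n∸m]≡n k≤n)) (cong (λ z → mod n (z + (n ∸ k))) (sym i≡))))
  move-stepOf {u i} {v j} (_ , i≡j) = cong v i≡j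
  move-stepOf {v i} {u j} (_ , i≡j) = cong u i≡j

  vertices≡trace : ∀ {x z} (w : Walk x z) → vertices w ≡ trace x (steps w)
  vertices≡trace end         = refl
  vertices≡trace {x} (a ▸ w) =
    cong (x ∷_) (trans (vertices≡trace w) (cong (λ y → trace y (steps w)) (sym (move-stepOf a))))

  len-vertices : ∀ {x z} (w : Walk x z) → len (vertices w) ≡ length (steps w)
  len-vertices end     = refl
  len-vertices (_ ▸ w) = cong suc (len-vertices w)

  spokes-vertices : ∀ {x z} (w : Walk x z) → spokes (vertices w) ≡ count spoke (steps w)
  spokes-vertices end                                      = refl
  spokes-vertices {u _} (_▸_ {y = u _} (_ , _ , inj₁ _) w) = spokes-vertices w
  spokes-vertices {u _} (_▸_ {y = u _} (_ , _ , inj₂ _) w) = spokes-vertices w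
  spokes-vertices {v _} (_▸_ {y = v _} (_ , _ , inj₁ _) w) = spokes-vertices w
  spokes-vertices {v _} (_▸_ {y = v _} (_ , _ , inj₂ _) w) = spokes-vertices w
  spokes-vertices {u _} (_▸_ {y = v _} _ w)                = cong suc (spokes-vertices w)
  spokes-vertices {v _} (_▸_ {y = u _} _ w)                = cong suc (spokes-vertices w)

  length≡cost+spokes : ∀ σs → length σs ≡ cost σs + count spoke σs
  length≡cost+spokes []            = refl
  length≡cost+spokes (outer⁺ ∷ σs) = cong suc (length≡cost+spokes σs)
  length≡cost+spokes (outer⁻ ∷ σs) = trans (cong suc (length≡cost+spokes σs))
    (cong (λ z → z + count inner⁺ σs + count inner⁻ σs + count spoke σs) (sym (+-suc (count outer⁺ σs) _)))
  length≡cost+spokes (inner⁺ ∷ σs) = trans (cong suc (length≡cost+spokes σs))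
    (cong (λ z → z + count inner⁻ σs + count spoke σs) (sym (+-suc (count outer⁺ σs + count outer⁻ σs) _)))
  length≡cost+spokes (inner⁻ ∷ σs) = trans (cong suc (length≡cost+spokes σs))
    (cong (_+ count spoke σs) (sym (+-suc (count outer⁺ σs + count outer⁻ σs + count inner⁺ σs) _)))
  length≡cost+spokes (spoke ∷ σs)  = trans (cong suc (length≡cost+spokes σs)) (sym (+-suc (cost σs) _))

  u→v-has-spoke : ∀ {i j} (w : Walk (u i) (v j)) → 1 ≤ count spoke (steps w)
  u→v-has-spoke (_▸_ {y = u _} (_ , _ , inj₁ _) w) = u→v-has-spoke w
  u→v-has-spoke (_▸_ {y = u _} (_ , _ , inj₂ _) w) = u→v-has-spoke w
  u→v-has-spoke (_▸_ {y = v _} _ w)                = s≤s z≤n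

  walk-from-chain : ∀ {x z l} → Chain n k (x ∷ l) → last (x ∷ l) ≡ just z →
    ∃ λ (w : Walk x z) → vertices w ≡ x ∷ l
  walk-from-chain (one _)        refl = end , refl
  walk-from-chain {x} (cons a c) e with walk-from-chain c e
  ... | w , w≡ = a ▸ w , cong (x ∷_) w≡

  walk-of : ∀ {x z P} → IsWalk n k x z P → ∃ λ (w : Walk x z) → vertices w ≡ P
  walk-of {P = []}    (_ , () , _)
  walk-of {P = _ ∷ _} (c , refl , last≡) = walk-from-chain c last≡

  index-invariant : ∀ {x z} (w : Walk x z) → let σs = steps w in
    index z + count outer⁻ σs + k * count inner⁻ σs ≋ index x + count outer⁺ σs + k * count inner⁺ σs
  index-invariant end = ≋-refl
  index-invariant {u i} {z} (_▸_ {y = u j} (_ , _ , inj₁ j≡) w) = begin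
    index z + B + k * D       ≈⟨ index-invariant w ⟩
    j + A + k * C             ≡⟨ cong (λ x → x + A + k * C) j≡ ⟩
    (i + 1) % n + A + k * C   ≈⟨ +-congʳ-≋ (k * C) (+-congʳ-≋ A (%-≋ (i + 1))) ⟩
    i + 1 + A + k * C         ≡⟨ cong (_+ k * C) (+-assoc i 1 A) ⟩
    i + suc A + k * C         ∎
    where
    open ≋-Reasoning
    A = count outer⁺ (steps w); B = count outer⁻ (steps w)
    C = count inner⁺ (steps w); D = count inner⁻ (steps w)
  index-invariant {u i} {z} (_▸_ {y = u j} (_ , _ , inj₂ i≡) w) = begin
    index z + suc B + k * D   ≡⟨ cong (_+ k * D) (+-assoc (index z) 1 B) ⟨
    index z + 1 + B + k * D   ≡⟨ cong (_+ k * D) (xy∙z≈xz∙y (index z) 1 B) ⟩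
    index z + B + 1 + k * D   ≡⟨ xy∙z≈xz∙y (index z + B) 1 (k * D) ⟩
    index z + B + k * D + 1   ≈⟨ +-congʳ-≋ 1 (index-invariant w) ⟩
    j + A + k * C + 1         ≡⟨ xy∙z≈xz∙y (j + A) 1 (k * C) ⟨
    j + A + 1 + k * C         ≡⟨ cong (_+ k * C) (xy∙z≈xz∙y j 1 A) ⟨
    j + 1 + A + k * C         ≈⟨ +-congʳ-≋ (k * C) (+-congʳ-≋ A (%-≋ (j + 1))) ⟨
    (j + 1) % n + A + k * C   ≡⟨ cong (λ x → x + A + k * C) i≡ ⟨
    i + A + k * C             ∎
    where
    open ≋-Reasoning
    A = count outer⁺ (steps w); B = count outer⁻ (steps w)
    C = count inner⁺ (steps w); D = count inner⁻ (steps w)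
  index-invariant {v i} {z} (_▸_ {y = v j} (_ , _ , inj₁ j≡) w) = begin
    index z + B + k * D       ≈⟨ index-invariant w ⟩
    j + A + k * C             ≡⟨ cong (λ x → x + A + k * C) j≡ ⟩
    (i + k) % n + A + k * C   ≈⟨ +-congʳ-≋ (k * C) (+-congʳ-≋ A (%-≋ (i + k))) ⟩
    i + k + A + k * C         ≡⟨ cong (_+ k * C) (xy∙z≈xz∙y i k A) ⟩
    i + A + k + k * C         ≡⟨ +-assoc (i + A) k (k * C) ⟩
    i + A + (k + k * C)       ≡⟨ cong (i + A +_) (*-suc k C) ⟨
    i + A + k * suc C         ∎
    where
    open ≋-Reasoning
    A = count outer⁺ (steps w); B = count outer⁻ (steps w)
    C = count inner⁺ (steps w); D = count inner⁻ (steps w)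
  index-invariant {v i} {z} (_▸_ {y = v j} (_ , _ , inj₂ i≡) w) = begin
    index z + B + k * suc D   ≡⟨ cong (index z + B +_) (*-suc k D) ⟩
    index z + B + (k + k * D) ≡⟨ +-assoc (index z + B) k (k * D) ⟨
    index z + B + k + k * D   ≡⟨ xy∙z≈xz∙y (index z + B) k (k * D) ⟩
    index z + B + k * D + k   ≈⟨ +-congʳ-≋ k (index-invariant w) ⟩
    j + A + k * C + k         ≡⟨ xy∙z≈xz∙y (j + A) k (k * C) ⟨
    j + A + k + k * C         ≡⟨ cong (_+ k * C) (xy∙z≈xz∙y j k A) ⟨
    j + k + A + k * C         ≈⟨ +-congʳ-≋ (k * C) (+-congʳ-≋ A (%-≋ (j + k))) ⟨
    (j + k) % n + A + k * C   ≡⟨ cong (λ x → x + A + k * C) i≡ ⟨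
    i + A + k * C             ∎
    where
    open ≋-Reasoning
    A = count outer⁺ (steps w); B = count outer⁻ (steps w)
    C = count inner⁺ (steps w); D = count inner⁻ (steps w)
  index-invariant {u i} (_▸_ {y = v j} (_ , refl) w) = index-invariant w
  index-invariant {v i} (_▸_ {y = u j} (_ , refl) w) = index-invariant w

  data Outer : Step → Step → Set where
    forward  : Outer outer⁺ outer⁻
    backward : Outer outer⁻ outer⁺

  data Inner : Step → Step → Set where
    forward  : Inner inner⁺ inner⁻
    backward : Inner inner⁻ inner⁺

  shape : ℕ → Step → ℕ → Step → List Step
  shape a σ c τ = replicate a σ ++ spoke ∷ replicate c τ

  cost≡counts : ∀ {σ σ̄ τ τ̄} → Outer σ σ̄ → Inner τ τ̄ → ∀ σs →
    cost σs ≡ count σ σs + count σ̄ σs + (count τ σs + count τ̄ σs)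
  cost≡counts forward  forward  σs = +-assoc (count outer⁺ σs + count outer⁻ σs) _ _
  cost≡counts forward  backward σs = trans (+-assoc (count outer⁺ σs + count outer⁻ σs) _ _)
    (cong (count outer⁺ σs + count outer⁻ σs +_) (+-comm (count inner⁺ σs) _))
  cost≡counts backward forward  σs = trans (+-assoc (count outer⁺ σs + count outer⁻ σs) _ _)
    (cong (_+ (count inner⁺ σs + count inner⁻ σs)) (+-comm (count outer⁺ σs) _))
  cost≡counts backward backward σs = trans (+-assoc (count outer⁺ σs + count outer⁻ σs) _ _)
    (cong₂ _+_ (+-comm (count outer⁺ σs) _) (+-comm (count inner⁺ σs) _))

  count-outer-replicate-inner : ∀ {σ σ̄ τ τ̄} → Outer σ σ̄ → Inner τ τ̄ → ∀ c → count σ (replicate c τ) ≡ 0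
  count-outer-replicate-inner _        _        zero    = refl
  count-outer-replicate-inner forward  forward  (suc c) = count-outer-replicate-inner forward forward c
  count-outer-replicate-inner forward  backward (suc c) = count-outer-replicate-inner forward backward c
  count-outer-replicate-inner backward forward  (suc c) = count-outer-replicate-inner backward forward c
  count-outer-replicate-inner backward backward (suc c) = count-outer-replicate-inner backward backward c

  inner-steps : ∀ {τ τ̄ i j} → Inner τ τ̄ → (w : Walk (v i) (v j)) →
    count spoke (steps w) ≡ 0 → count τ̄ (steps w) ≡ 0 → steps w ≡ replicate (count τ (steps w)) τ
  inner-steps _        end                                    _   _    = refl
  inner-steps _        (_▸_ {y = u _} _ w)                    ()  _
  inner-steps forward  (_▸_ {y = v _} (_ , _ , inj₁ _) w) s≡0 τ̄≡0 = cong (inner⁺ ∷_) (inner-steps forward w s≡0 τ̄≡0)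
  inner-steps forward  (_▸_ {y = v _} (_ , _ , inj₂ _) w) _   ()
  inner-steps backward (_▸_ {y = v _} (_ , _ , inj₁ _) w) _   ()
  inner-steps backward (_▸_ {y = v _} (_ , _ , inj₂ _) w) s≡0 τ̄≡0 = cong (inner⁻ ∷_) (inner-steps backward w s≡0 τ̄≡0)

  spoke∷inner≡shape : ∀ {σ σ̄ τ τ̄} → Outer σ σ̄ → Inner τ τ̄ → ∀ {σs} → σs ≡ replicate (count τ σs) τ →
    spoke ∷ σs ≡ shape (count σ σs) σ (count τ σs) τ
  spoke∷inner≡shape {σ} {τ = τ} σ-dir τ-dir {σs} σs≡ = begin
    spoke ∷ σs                  ≡⟨ cong (spoke ∷_) σs≡ ⟩
    shape 0 σ c τ               ≡⟨ cong (λ a → shape a σ c τ) no-outer ⟨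
    shape (count σ σs) σ c τ    ∎
    where
    open ≡-Reasoning
    c = count τ σs
    no-outer : count σ σs ≡ 0
    no-outer = trans (cong (count σ) σs≡) (count-outer-replicate-inner σ-dir τ-dir c)

  -- The outer and inner directions are matched so that count reduces on the first step.
  steps≡shape : ∀ {σ σ̄ τ τ̄ i j} → Outer σ σ̄ → Inner τ τ̄ → (w : Walk (u i) (v j)) → let σs = steps w in
    count spoke σs ≡ 1 → count σ̄ σs ≡ 0 → count τ̄ σs ≡ 0 → σs ≡ shape (count σ σs) σ (count τ σs) τ
  steps≡shape forward  forward  (_▸_ {y = u _} (_ , _ , inj₁ _) w) s≡1 σ̄≡0 τ̄≡0 =
    cong (outer⁺ ∷_) (steps≡shape forward forward w s≡1 σ̄≡0 τ̄≡0)
  steps≡shape forward  backward (_▸_ {y = u _} (_ , _ , inj₁ _) w) s≡1 σ̄≡0 τ̄≡0 =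
    cong (outer⁺ ∷_) (steps≡shape forward backward w s≡1 σ̄≡0 τ̄≡0)
  steps≡shape backward forward  (_▸_ {y = u _} (_ , _ , inj₂ _) w) s≡1 σ̄≡0 τ̄≡0 =
    cong (outer⁻ ∷_) (steps≡shape backward forward w s≡1 σ̄≡0 τ̄≡0)
  steps≡shape backward backward (_▸_ {y = u _} (_ , _ , inj₂ _) w) s≡1 σ̄≡0 τ̄≡0 =
    cong (outer⁻ ∷_) (steps≡shape backward backward w s≡1 σ̄≡0 τ̄≡0)
  steps≡shape forward  _ (_▸_ {y = u _} (_ , _ , inj₂ _) w) _ () _
  steps≡shape backward _ (_▸_ {y = u _} (_ , _ , inj₁ _) w) _ () _
  steps≡shape forward  forward  (_▸_ {y = v _} _ w) s≡1 _ τ̄≡0 =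
    spoke∷inner≡shape forward forward (inner-steps forward w (suc-injective s≡1) τ̄≡0)
  steps≡shape forward  backward (_▸_ {y = v _} _ w) s≡1 _ τ̄≡0 =
    spoke∷inner≡shape forward backward (inner-steps backward w (suc-injective s≡1) τ̄≡0)
  steps≡shape backward forward  (_▸_ {y = v _} _ w) s≡1 _ τ̄≡0 =
    spoke∷inner≡shape backward forward (inner-steps forward w (suc-injective s≡1) τ̄≡0)
  steps≡shape backward backward (_▸_ {y = v _} _ w) s≡1 _ τ̄≡0 =
    spoke∷inner≡shape backward backward (inner-steps backward w (suc-injective s≡1) τ̄≡0)

  Valid : V → List Step → Set
  Valid x []       = ⊤
  Valid x (σ ∷ σs) = Adj n k x (move σ x) × Valid (move σ x) σs

  endpoint : V → List Step → V
  endpoint x []       = x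
  endpoint x (σ ∷ σs) = endpoint (move σ x) σs

  valid⇒chain : ∀ x σs → Valid x σs → Chain n k (trace x σs)
  valid⇒chain x []            _       = one x
  valid⇒chain x (σ ∷ [])      (a , _) = cons a (one _)
  valid⇒chain x (σ ∷ σ′ ∷ σs) (a , p) = cons a (valid⇒chain _ (σ′ ∷ σs) p)

  last-trace : ∀ x σs → last (trace x σs) ≡ just (endpoint x σs)
  last-trace x []            = refl
  last-trace x (σ ∷ [])      = refl
  last-trace x (σ ∷ σ′ ∷ σs) = last-trace (move σ x) (σ′ ∷ σs)

  length-trace : ∀ x σs → length (trace x σs) ≡ suc (length σs)
  length-trace x []       = refl
  length-trace x (σ ∷ σs) = cong suc (length-trace (move σ x) σs)

  endpoint-++ : ∀ x σs τs → endpoint x (σs ++ τs) ≡ endpoint (endpoint x σs) τs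
  endpoint-++ x []       τs = refl
  endpoint-++ x (σ ∷ σs) τs = endpoint-++ (move σ x) σs τs

  trace-replicate : ∀ x c τ → trace x (replicate c τ) ≡ applyUpTo (λ t → endpoint x (replicate t τ)) (suc c)
  trace-replicate x zero    τ = refl
  trace-replicate x (suc c) τ = cong (x ∷_) (trace-replicate (move τ x) c τ)

  trace-shape : ∀ x a σ c τ → let y = move spoke (endpoint x (replicate a σ)) in
    trace x (shape a σ c τ) ≡
      applyUpTo (λ t → endpoint x (replicate t σ)) (suc a) ++ applyUpTo (λ t → endpoint y (replicate t τ)) (suc c)
  trace-shape x zero    σ c τ = cong (x ∷_) (trace-replicate (move spoke x) c τ)
  trace-shape x (suc a) σ c τ = cong (x ∷_) (trace-shape (move σ x) a σ c τ)

  endpoint-shape : ∀ x a σ c τ →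
    endpoint x (shape a σ c τ) ≡ endpoint (move spoke (endpoint x (replicate a σ))) (replicate c τ)
  endpoint-shape x a σ c τ = endpoint-++ x (replicate a σ) (spoke ∷ replicate c τ)

  length-shape : ∀ a σ c τ → length (shape a σ c τ) ≡ a + suc c
  length-shape a σ c τ =
    trans (length-++ (replicate a σ)) (cong₂ _+_ (length-replicate a) (cong suc (length-replicate c)))

  valid-inner : ∀ {τ τ̄} → Inner τ τ̄ → ∀ c i → i < n → Valid (v i) (replicate c τ)
  valid-inner _        zero    _ _   = tt
  valid-inner forward  (suc c) i i<n =
    (i<n , m%n<n (i + k) n , inj₁ refl) , valid-inner forward c _ (m%n<n (i + k) n)
  valid-inner backward (suc c) i i<n =
    (i<n , m%n<n (i + (n ∸ k)) n , inj₂ (undo-step (n ∸ k) k i<n (m∸n+n≡m k≤n))) ,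
    valid-inner backward c _ (m%n<n (i + (n ∸ k)) n)

  valid-outer : ∀ {σ σ̄} → Outer σ σ̄ → ∀ {σs} → (∀ i → i < n → Valid (u i) σs) →
    ∀ a i → i < n → Valid (u i) (replicate a σ ++ σs)
  valid-outer _        then zero    i i<n = then i i<n
  valid-outer forward  then (suc a) i i<n =
    (i<n , m%n<n (i + 1) n , inj₁ refl) , valid-outer forward then a _ (m%n<n (i + 1) n)
  valid-outer backward then (suc a) i i<n =
    (i<n , m%n<n (i + n′) n , inj₂ (undo-step n′ 1 i<n (+-comm n′ 1))) ,
    valid-outer backward then a _ (m%n<n (i + n′) n)

  valid-shape : ∀ {σ σ̄ τ τ̄} → Outer σ σ̄ → Inner τ τ̄ → ∀ a c → Valid (u 0) (shape a σ c τ)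
  valid-shape σ-dir τ-dir a c = valid-outer σ-dir (λ i i<n → (i<n , refl) , valid-inner τ-dir c i i<n) a 0 (s≤s z≤n)

  chain-tail : ∀ {x l} → Chain n k (x ∷ l) → Chain n k l
  chain-tail (one _)    = nil
  chain-tail (cons _ c) = c

  ⊑-chain : ∀ {s l} → s ⊑ l → Chain n k l → Chain n k s
  ⊑-chain here      c = c
  ⊑-chain (there s) c = ⊑-chain s (chain-tail c)

  Shortcut : V → List V → List V → Set
  Shortcut x l p = Chain n k p × head p ≡ just x × last p ≡ last l × Unique p × length p ≤ length l

  prepend-shortcut : ∀ {x y r} → Adj n k x y → Chain n k (y ∷ r) → Unique (y ∷ r) →
    Shortcut x (x ∷ y ∷ r) (prepend x (y ∷ r))
  prepend-shortcut {x} {y} {r} a c uniq with suffixFrom x (y ∷ r) in eq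
  ... | []    = cons a c , refl , refl , suffixFrom≡[] x (y ∷ r) eq AllPairs.∷ uniq , ≤-refl
  ... | _ ∷ _ with suffixFrom≡∷ x (y ∷ r) eq
  ...   | refl , s = ⊑-chain s c , refl , ⊑-last s , ⊑-unique s uniq , m≤n⇒m≤1+n (⊑-length s)

  shortcut-shortcut : ∀ {x l} → Chain n k (x ∷ l) → Shortcut x (x ∷ l) (shortcut (x ∷ l))
  shortcut-shortcut {x} {[]}    _          = one x , refl , refl , All.[] AllPairs.∷ AllPairs.[] , ≤-refl
  shortcut-shortcut {x} {y ∷ l} (cons a c) with shortcut (y ∷ l) | shortcut-shortcut c
  ... | y′ ∷ r | c′ , refl , last≡ , uniq′ , ≤l with prepend-shortcut a c′ uniq′
  ...   | c″ , head≡ , last≡′ , uniq″ , ≤l′ = c″ , head≡ , trans last≡′ last≡ , uniq″ , ≤-trans ≤l′ (s≤s ≤l)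

  valid⇒path : ∀ x σs → Valid x σs → ∃ λ p → IsPath n k x (endpoint x σs) p × len p ≤ length σs
  valid⇒path x []       _     = x ∷ [] , ((one x , refl , refl) , All.[] AllPairs.∷ AllPairs.[]) , z≤n
  valid⇒path x (σ ∷ σs) valid with shortcut-shortcut (valid⇒chain x (σ ∷ σs) valid)
  ... | c , head≡ , last≡ , uniq , ≤l =
    shortcut (trace x (σ ∷ σs)) , ((c , head≡ , trans last≡ (last-trace x (σ ∷ σs))) , uniq) ,
    ∸-monoˡ-≤ 1 (≤-trans ≤l (≤-reflexive (length-trace x (σ ∷ σs))))

  shortest≤shape : ∀ {z P σ σ̄ τ τ̄} → IsShortestPath n k (u 0) z P → Outer σ σ̄ → Inner τ τ̄ →
    ∀ a c → endpoint (u 0) (shape a σ c τ) ≡ z → len P ≤ a + suc c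
  shortest≤shape {σ = σ} {τ = τ} (_ , minimal) σ-dir τ-dir a c refl
    with valid⇒path (u 0) (shape a σ c τ) (valid-shape σ-dir τ-dir a c)
  ... | p , path , len≤ = ≤-trans (minimal p path) (≤-trans len≤ (≤-reflexive (length-shape a σ c τ)))

  -- The four candidate walks

  endpoint-replicate : ∀ (X : ℕ → V) δ σ → (∀ i → move σ (X i) ≡ X (mod n (i + δ))) →
    ∀ t i → i < n → endpoint (X i) (replicate t σ) ≡ X (mod n (i + t * δ))
  endpoint-replicate X δ σ move≡ zero i i<n =
    cong X (trans (sym (m<n⇒m%n≡m i<n)) (cong (_% n) (sym (+-identityʳ i))))
  endpoint-replicate X δ σ move≡ (suc t) i i<n = begin
    endpoint (move σ (X i)) (replicate t σ)     ≡⟨ cong (λ y → endpoint y (replicate t σ)) (move≡ i) ⟩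
    endpoint (X ((i + δ) % n)) (replicate t σ)  ≡⟨ endpoint-replicate X δ σ move≡ t _ (m%n<n (i + δ) n) ⟩
    X (((i + δ) % n + t * δ) % n)               ≡⟨ cong X (≋⇒%≡ (+-congʳ-≋ (t * δ) (%-≋ (i + δ)))) ⟩
    X ((i + δ + t * δ) % n)                     ≡⟨ cong (λ z → X (z % n)) (+-assoc i δ (t * δ)) ⟩
    X ((i + suc t * δ) % n)                     ∎
    where open ≡-Reasoning

  outer⁺-from-0 : ∀ t → endpoint (u 0) (replicate t outer⁺) ≡ u (mod n t)
  outer⁺-from-0 t = trans (endpoint-replicate u 1 outer⁺ (λ _ → refl) t 0 (s≤s z≤n))
    (cong (λ z → u (z % n)) (*-identityʳ t))

  outer⁻-from-0 : ∀ t → endpoint (u 0) (replicate t outer⁻) ≡ u (neg n t)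
  outer⁻-from-0 t = trans (endpoint-replicate u n′ outer⁻ (λ _ → refl) t 0 (s≤s z≤n))
    (cong u (inverse⇒≡neg (t * n′) t (begin
      t * n′ + t     ≡⟨ +-comm (t * n′) t ⟩
      t + t * n′     ≡⟨ *-suc t n′ ⟨
      t * n          ≈⟨ *n≋0 t ⟩
      0              ∎)))
    where open ≋-Reasoning

  inner⁺-from : ∀ t i → i < n → endpoint (v i) (replicate t inner⁺) ≡ v (mod n (i + t * k))
  inner⁺-from = endpoint-replicate v k inner⁺ (λ _ → refl)

  inner⁻-from : ∀ t i → i < n → endpoint (v i) (replicate t inner⁻) ≡ v (mod n (i + t * (n ∸ k)))
  inner⁻-from = endpoint-replicate v (n ∸ k) inner⁻ (λ _ → refl)

  P₁-inner : ∀ j₀ t →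
    endpoint (move spoke (endpoint (u 0) (replicate j₀ outer⁺))) (replicate t inner⁺) ≡ v (mod n (t * k + j₀))
  P₁-inner j₀ t rewrite outer⁺-from-0 j₀ = trans (inner⁺-from t (j₀ % n) (m%n<n j₀ n)) (cong v (≋⇒%≡ (begin
    j₀ % n + t * k   ≈⟨ +-congʳ-≋ (t * k) (%-≋ j₀) ⟩
    j₀ + t * k       ≡⟨ +-comm j₀ (t * k) ⟩
    t * k + j₀       ∎)))
    where open ≋-Reasoning

  P₂-inner : ∀ j₀ → j₀ ≤ k → ∀ t → let x = k ∸ j₀ in
    endpoint (move spoke (endpoint (u 0) (replicate x outer⁻))) (replicate (suc t) inner⁺) ≡ v (mod n (t * k + j₀))
  P₂-inner j₀ j₀≤k t rewrite outer⁻-from-0 (k ∸ j₀) =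
    trans (inner⁺-from (suc t) (neg n x) (m%n<n (n ∸ x % n) n)) (cong v (≋⇒%≡ (begin
      neg n x + (k + t * k)          ≡⟨ cong (λ z → neg n x + (z + t * k)) (m∸n+n≡m j₀≤k) ⟨
      neg n x + (x + j₀ + t * k)     ≡⟨ cong (neg n x +_) (+-assoc x j₀ (t * k)) ⟩
      neg n x + (x + (j₀ + t * k))   ≡⟨ +-assoc (neg n x) x (j₀ + t * k) ⟨
      neg n x + x + (j₀ + t * k)     ≈⟨ +-congʳ-≋ (j₀ + t * k) (neg-inverseˡ x) ⟩
      j₀ + t * k                     ≡⟨ +-comm j₀ (t * k) ⟩
      t * k + j₀                     ∎)))
    where
    open ≋-Reasoning
    x = k ∸ j₀

  P₃-inner : ∀ j₁ t →
    endpoint (move spoke (endpoint (u 0) (replicate j₁ outer⁻))) (replicate t inner⁻) ≡ v (neg n (t * k + j₁))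
  P₃-inner j₁ t rewrite outer⁻-from-0 j₁ = trans (inner⁻-from t (neg n j₁) (m%n<n (n ∸ j₁ % n) n))
    (cong v (inverse⇒≡neg (neg n j₁ + t * (n ∸ k)) (t * k + j₁) (begin
      neg n j₁ + t * (n ∸ k) + (t * k + j₁)   ≡⟨ interleave (neg n j₁) (n ∸ k) t k j₁ ⟩
      neg n j₁ + j₁ + t * (n ∸ k + k)         ≡⟨ cong (λ z → neg n j₁ + j₁ + t * z) (m∸n+n≡m k≤n) ⟩
      neg n j₁ + j₁ + t * n                   ≈⟨ +-cong-≋ (neg-inverseˡ j₁) (*n≋0 t) ⟩
      0                                       ∎)))
    where
    open ≋-Reasoning
    interleave : ∀ a d t k j → a + t * d + (t * k + j) ≡ a + j + t * (d + k)
    interleave = solve-∀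

  P₄-inner : ∀ j₁ → j₁ ≤ k → ∀ t → let x = k ∸ j₁ in
    endpoint (move spoke (endpoint (u 0) (replicate x outer⁺))) (replicate (suc t) inner⁻) ≡ v (neg n (t * k + j₁))
  P₄-inner j₁ j₁≤k t rewrite outer⁺-from-0 (k ∸ j₁) = trans (inner⁻-from (suc t) (x % n) (m%n<n x n))
    (cong v (inverse⇒≡neg (x % n + suc t * (n ∸ k)) (t * k + j₁) (begin
      x % n + suc t * (n ∸ k) + (t * k + j₁)  ≈⟨ +-congʳ-≋ (t * k + j₁) (+-congʳ-≋ (suc t * (n ∸ k)) (%-≋ x)) ⟩
      x + suc t * (n ∸ k) + (t * k + j₁)      ≡⟨ interleave x (n ∸ k) t k j₁ ⟩
      x + j₁ + (n ∸ k) + t * (n ∸ k + k)      ≡⟨ cong₂ (λ a b → a + (n ∸ k) + t * b) (m∸n+n≡m j₁≤k) (m∸n+n≡m k≤n) ⟩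
      k + (n ∸ k) + t * n                     ≡⟨ cong (_+ t * n) (m+[n∸m]≡n k≤n) ⟩
      n + t * n                               ≈⟨ +-cong-≋ n≋0 (*n≋0 t) ⟩
      0                                       ∎)))
    where
    open ≋-Reasoning
    x = k ∸ j₁
    interleave : ∀ a d t k j → a + suc t * d + (t * k + j) ≡ a + j + d + t * (d + k)
    interleave = solve-∀

  applyUpTo≗map : ∀ {f g : ℕ → V} → (∀ t → f t ≡ g t) → ∀ m → applyUpTo f m ≡ map g (upTo m)
  applyUpTo≗map {f} f≗g m = trans (sym (map-upTo f m)) (map-cong f≗g (upTo m))

  trace-P₁ : ∀ j₀ m₀ → trace (u 0) (shape j₀ outer⁺ m₀ inner⁺) ≡ P₁ n k j₀ m₀
  trace-P₁ j₀ m₀ = trans (trace-shape (u 0) j₀ outer⁺ m₀ inner⁺)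
    (cong₂ _++_ (applyUpTo≗map outer⁺-from-0 (suc j₀)) (applyUpTo≗map (P₁-inner j₀) (suc m₀)))

  trace-P₂ : ∀ j₀ m₀ → j₀ ≤ k → trace (u 0) (shape (k ∸ j₀) outer⁻ (suc m₀) inner⁺) ≡ P₂ n k j₀ m₀
  trace-P₂ j₀ m₀ j₀≤k = trans (trace-shape (u 0) (k ∸ j₀) outer⁻ (suc m₀) inner⁺)
    (cong₂ _++_ (applyUpTo≗map outer⁻-from-0 (suc (k ∸ j₀)))
      (cong₂ _∷_ (cong (move spoke) (outer⁻-from-0 (k ∸ j₀))) (applyUpTo≗map (P₂-inner j₀ j₀≤k) (suc m₀))))

  trace-P₃ : ∀ j₁ m₁ → trace (u 0) (shape j₁ outer⁻ m₁ inner⁻) ≡ P₃ n k j₁ m₁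
  trace-P₃ j₁ m₁ = trans (trace-shape (u 0) j₁ outer⁻ m₁ inner⁻)
    (cong₂ _++_ (applyUpTo≗map outer⁻-from-0 (suc j₁)) (applyUpTo≗map (P₃-inner j₁) (suc m₁)))

  trace-P₄ : ∀ j₁ m₁ → j₁ ≤ k → trace (u 0) (shape (k ∸ j₁) outer⁺ (suc m₁) inner⁻) ≡ P₄ n k j₁ m₁
  trace-P₄ j₁ m₁ j₁≤k = trans (trace-shape (u 0) (k ∸ j₁) outer⁺ (suc m₁) inner⁻)
    (cong₂ _++_ (applyUpTo≗map outer⁺-from-0 (suc (k ∸ j₁)))
      (cong₂ _∷_ (cong (move spoke) (outer⁺-from-0 (k ∸ j₁))) (applyUpTo≗map (P₄-inner j₁ j₁≤k) (suc m₁))))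

  module _ {j} (1≤j : 1 ≤ j) (j<n : j < n) where

    mod-index : ∀ {e} → j ≡ e → mod n e ≡ j
    mod-index refl = m<n⇒m%n≡m j<n

    neg-index : ∀ {e} → n ∸ j ≡ e → neg n e ≡ j
    neg-index refl = begin
      (n ∸ (n ∸ j) % n) % n   ≡⟨ cong (λ z → (n ∸ z) % n) (m<n⇒m%n≡m (∸-monoʳ-< 1≤j (<⇒≤ j<n))) ⟩
      (n ∸ (n ∸ j)) % n       ≡⟨ cong (_% n) (m∸[m∸n]≡n (<⇒≤ j<n)) ⟩
      j % n                   ≡⟨ m<n⇒m%n≡m j<n ⟩
      j                       ∎
      where open ≡-Reasoning

    endpoint-P₁ : ∀ j₀ m₀ → j ≡ m₀ * k + j₀ → endpoint (u 0) (shape j₀ outer⁺ m₀ inner⁺) ≡ v j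
    endpoint-P₁ j₀ m₀ j≡ = trans (endpoint-shape (u 0) j₀ outer⁺ m₀ inner⁺)
      (trans (P₁-inner j₀ m₀) (cong v (mod-index j≡)))

    endpoint-P₂ : ∀ j₀ m₀ → j ≡ m₀ * k + j₀ → j₀ ≤ k →
      endpoint (u 0) (shape (k ∸ j₀) outer⁻ (suc m₀) inner⁺) ≡ v j
    endpoint-P₂ j₀ m₀ j≡ j₀≤k = trans (endpoint-shape (u 0) (k ∸ j₀) outer⁻ (suc m₀) inner⁺)
      (trans (P₂-inner j₀ j₀≤k m₀) (cong v (mod-index j≡)))

    endpoint-P₃ : ∀ j₁ m₁ → n ∸ j ≡ m₁ * k + j₁ → endpoint (u 0) (shape j₁ outer⁻ m₁ inner⁻) ≡ v j
    endpoint-P₃ j₁ m₁ n-j≡ = trans (endpoint-shape (u 0) j₁ outer⁻ m₁ inner⁻)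
      (trans (P₃-inner j₁ m₁) (cong v (neg-index n-j≡)))

    endpoint-P₄ : ∀ j₁ m₁ → n ∸ j ≡ m₁ * k + j₁ → j₁ ≤ k →
      endpoint (u 0) (shape (k ∸ j₁) outer⁺ (suc m₁) inner⁻) ≡ v j
    endpoint-P₄ j₁ m₁ n-j≡ j₁≤k = trans (endpoint-shape (u 0) (k ∸ j₁) outer⁺ (suc m₁) inner⁻)
      (trans (P₄-inner j₁ j₁≤k m₁) (cong v (neg-index n-j≡)))

  -- Shortest paths

  module Shortest {j m₀ j₀ m₁ j₁ P}
    (3≤k : 3 ≤ k) (bound≤n : bound k ≤ n) (1≤j : 1 ≤ j) (2j≤n : 2 * j ≤ n)
    (j≡ : j ≡ m₀ * k + j₀) (j₀<k : j₀ < k) (n-j≡ : n ∸ j ≡ m₁ * k + j₁) (j₁<k : j₁ < k)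
    (shortest : IsShortestPath n k (u 0) (v j) P) where

    j<n : j < n
    j<n = ≤-trans (+-monoˡ-≤ j 1≤j) (≤-trans (+-monoʳ-≤ j (≤-reflexive (sym (+-identityʳ j)))) 2j≤n)

    w : Walk (u 0) (v j)
    w = proj₁ (walk-of (proj₁ (proj₁ shortest)))

    w≡P : vertices w ≡ P
    w≡P = proj₂ (walk-of (proj₁ (proj₁ shortest)))

    σs : List Step
    σs = steps w

    len-P : len P ≡ cost σs + count spoke σs
    len-P = trans (cong len (sym w≡P)) (trans (len-vertices w) (length≡cost+spokes σs))

    len-P≤ : ∀ {σ σ̄ τ τ̄} → Outer σ σ̄ → Inner τ τ̄ → ∀ a c → endpoint (u 0) (shape a σ c τ) ≡ v j →
      cost σs + count spoke σs ≤ suc (a + c)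
    len-P≤ σ-dir τ-dir a c end≡ =
      ≤-trans (≤-reflexive (sym len-P))
        (≤-trans (shortest≤shape shortest σ-dir τ-dir a c end≡) (≤-reflexive (+-suc a c)))

    cost≤ : ∀ {σ σ̄ τ τ̄} → Outer σ σ̄ → Inner τ τ̄ → ∀ a c → endpoint (u 0) (shape a σ c τ) ≡ v j →
      cost σs ≤ a + c
    cost≤ σ-dir τ-dir a c end≡ = ≤-pred (begin
      suc (cost σs)             ≡⟨ +-comm 1 (cost σs) ⟩
      cost σs + 1               ≤⟨ +-monoʳ-≤ (cost σs) (u→v-has-spoke w) ⟩
      cost σs + count spoke σs  ≤⟨ len-P≤ σ-dir τ-dir a c end≡ ⟩
      suc (a + c)               ∎)
      where open ≤-Reasoning

    shape-of-profile : ∀ {σ σ̄ τ τ̄ a c} → Outer σ σ̄ → Inner τ τ̄ → endpoint (u 0) (shape a σ c τ) ≡ v j →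
      count σ σs ≡ a → count σ̄ σs ≡ 0 → count τ σs ≡ c → count τ̄ σs ≡ 0 →
      spokes P ≡ 1 × P ≡ trace (u 0) (shape a σ c τ)
    shape-of-profile {σ} {τ = τ} {a = a} {c} σ-dir τ-dir end≡ σ≡ σ̄≡ τ≡ τ̄≡ =
      trans (cong spokes (sym w≡P)) (trans (spokes-vertices w) spoke≡1) , P≡trace
      where
      cost≡ : cost σs ≡ a + c
      cost≡ = trans (cost≡counts σ-dir τ-dir σs)
        (cong₂ _+_ (trans (cong₂ _+_ σ≡ σ̄≡) (+-identityʳ a)) (trans (cong₂ _+_ τ≡ τ̄≡) (+-identityʳ c)))
      spoke≡1 : count spoke σs ≡ 1
      spoke≡1 = ≤-antisym
        (+-cancelˡ-≤ (cost σs) _ 1 (≤-trans (len-P≤ σ-dir τ-dir a c end≡)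
          (≤-reflexive (trans (cong suc (sym cost≡)) (+-comm 1 (cost σs))))))
        (u→v-has-spoke w)
      P≡trace : P ≡ trace (u 0) (shape a σ c τ)
      P≡trace = begin
        P                                                    ≡⟨ w≡P ⟨
        vertices w                                           ≡⟨ vertices≡trace w ⟩
        trace (u 0) σs                                       ≡⟨ cong (trace (u 0)) (steps≡shape σ-dir τ-dir w spoke≡1 σ̄≡ τ̄≡) ⟩
        trace (u 0) (shape (count σ σs) σ (count τ σs) τ)    ≡⟨ cong₂ (λ a c → trace (u 0) (shape a σ c τ)) σ≡ τ≡ ⟩
        trace (u 0) (shape a σ c τ)                          ∎
        where open ≡-Reasoning

    end₁ : endpoint (u 0) (shape j₀ outer⁺ m₀ inner⁺) ≡ v j
    end₁ = endpoint-P₁ 1≤j j<n j₀ m₀ j≡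

    end₂ : endpoint (u 0) (shape (k ∸ j₀) outer⁻ (suc m₀) inner⁺) ≡ v j
    end₂ = endpoint-P₂ 1≤j j<n j₀ m₀ j≡ (<⇒≤ j₀<k)

    end₃ : endpoint (u 0) (shape j₁ outer⁻ m₁ inner⁻) ≡ v j
    end₃ = endpoint-P₃ 1≤j j<n j₁ m₁ n-j≡

    end₄ : endpoint (u 0) (shape (k ∸ j₁) outer⁺ (suc m₁) inner⁻) ≡ v j
    end₄ = endpoint-P₄ 1≤j j<n j₁ m₁ n-j≡ (<⇒≤ j₁<k)

    classification : spokes P ≡ 1 × (P ≡ P₁ n k j₀ m₀ ⊎ P ≡ P₂ n k j₀ m₀ ⊎ P ≡ P₃ n k j₁ m₁ ⊎ P ≡ P₄ n k j₁ m₁)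
    classification with classify-profile n {k} {j} {m₀} {j₀} {m₁} {j₁} 3≤k bound≤n 2j≤n j≡ j₀<k n-j≡ j₁<k
      (≋⇒%≡ (index-invariant w))
      (cost≤ forward forward j₀ m₀ end₁) (cost≤ backward forward (k ∸ j₀) (suc m₀) end₂)
      (cost≤ backward backward j₁ m₁ end₃) (cost≤ forward backward (k ∸ j₁) (suc m₁) end₄)
    ... | inj₁ (A≡ , B≡ , C≡ , D≡) =
      Product.map₂ (λ P≡ → inj₁ (trans P≡ (trace-P₁ j₀ m₀)))
        (shape-of-profile forward forward end₁ A≡ B≡ C≡ D≡)
    ... | inj₂ (inj₁ (A≡ , B≡ , C≡ , D≡)) =
      Product.map₂ (λ P≡ → inj₂ (inj₁ (trans P≡ (trace-P₂ j₀ m₀ (<⇒≤ j₀<k)))))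
        (shape-of-profile backward forward end₂ B≡ A≡ C≡ D≡)
    ... | inj₂ (inj₂ (inj₁ (A≡ , B≡ , C≡ , D≡))) =
      Product.map₂ (λ P≡ → inj₂ (inj₂ (inj₁ (trans P≡ (trace-P₃ j₁ m₁)))))
        (shape-of-profile backward backward end₃ B≡ A≡ D≡ C≡)
    ... | inj₂ (inj₂ (inj₂ (A≡ , B≡ , C≡ , D≡))) =
      Product.map₂ (λ P≡ → inj₂ (inj₂ (inj₂ (trans P≡ (trace-P₄ j₁ m₁ (<⇒≤ j₁<k))))))
        (shape-of-profile forward backward end₄ A≡ B≡ D≡ C≡)

lemma2p1 : (n k : ℕ) → 3 ≤ k → 2 * k < n → bound k ≤ n →
    (j : ℕ) → 1 ≤ j → 2 * j ≤ n →
    (m₀ j₀ m₁ j₁ : ℕ) → j ≡ m₀ * k + j₀ → j₀ < k → n ∸ j ≡ m₁ * k + j₁ → j₁ < k →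
    (P : List V) → IsShortestPath n k (u 0) (v j) P →
    spokes P ≡ 1 ×
    (P ≡ P₁ n k j₀ m₀ ⊎ P ≡ P₂ n k j₀ m₀ ⊎ P ≡ P₃ n k j₁ m₁ ⊎ P ≡ P₄ n k j₁ m₁)
lemma2p1 zero     k _   ()  _ _ _ _ _ _ _ _ _ _ _ _ _ _
lemma2p1 (suc n′) k 3≤k 2k<n b j 1≤j 2j≤n m₀ j₀ m₁ j₁ j≡ j₀<k n-j≡ j₁<k P shortest =
  GP.Shortest.classification n′ k (≤-trans (m≤m+n k (k + 0)) (<⇒≤ 2k<n))
    3≤k b 1≤j 2j≤n j≡ j₀<k n-j≡ j₁<k shortest
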